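{- Let $P=(X,\prec)$ be a finite poset of width $w$. Then $\Omega(P,t)/t^w$ is weakly increasing as a function of $t\in\{1,2,3,\dots\}$.
   Context: The width of $P$ is the maximum size of an antichain (a set of pairwise incomparable elements). $\Omega(P,t)$ is the number of maps $g:X\to[t]$ with $g(x)\le g(y)$ whenever $x\prec y$. -}

module Defs where

open import Data.Nat using (ℕ; zero; suc; _≤_)
open import Data.Fin using (Fin; zero; suc; toℕ)
open import Data.Fin.Subset using (Subset; _∈_; ∣_∣)
open import Data.Fin.Properties using (all?)
open import Data.Nat.Properties using (_≤?_)
open import Data.List using (List; []; _∷_; map; concatMap; allFin; filter; length)
open import Data.Vec using (Vec; []; _∷_; lookup)
open import Data.Product using (_×_)
open import Data.Sum using (_⊎_)
open import Relation.Binary.PropositionalEquality using (_≡_)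
open import Relation.Binary.Core using (Rel)
open import Relation.Binary.Structures using (IsStrictPartialOrder)
open import Relation.Binary.Definitions using (Decidable)
open import Relation.Nullary using (¬_; Dec; yes; no)
open import Relation.Nullary.Decidable using (_→-dec_)

record FinPoset (n : ℕ) : Set₁ where
  field
    _≺_        : Rel (Fin n) _
    isStrictPO : IsStrictPartialOrder _≡_ _≺_
    _≺?_       : Decidable _≺_

module _ {n : ℕ} (P : FinPoset n) where
  open FinPoset P

  Comparable : Fin n → Fin n → Set
  Comparable x y = (x ≺ y) ⊎ (y ≺ x)

  IsAntichain : Subset n → Set
  IsAntichain A = ∀ x y → x ∈ A → y ∈ A → ¬ (x ≡ y) → ¬ Comparable x y

  HasWidth : ℕ → Set
  HasWidth w = (Data.Product.Σ (Subset n) λ A → IsAntichain A × ∣ A ∣ ≡ w)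
             × (∀ A → IsAntichain A → ∣ A ∣ ≤ w)

  OrderPreserving : ∀ {t} → Vec (Fin t) n → Set
  OrderPreserving g = ∀ x y → x ≺ y → toℕ (lookup g x) ≤ toℕ (lookup g y)

  orderPreserving? : ∀ {t} (g : Vec (Fin t) n) → Dec (OrderPreserving g)
  orderPreserving? g = all? λ x → all? λ y →
    (x ≺? y) →-dec (toℕ (lookup g x) ≤? toℕ (lookup g y))

allMaps : (m t : ℕ) → List (Vec (Fin t) m)
allMaps zero    t = [] ∷ []
allMaps (suc m) t = concatMap (λ i → map (i ∷_) (allMaps m t)) (allFin t)

Ω : ∀ {n} → FinPoset n → ℕ → ℕ
Ω {n} P t = length (filter (orderPreserving? P) (allMaps n t))

{-# OPTIONS --safe #-}
module Submission where

-- Fix an antichain A with |A| = w. We inject pairs (g, c), with g : X → [t] order-preserving and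
-- c : X → [t+1] minimal off A, into pairs (g′, c′), with g′ : X → [t+1] order-preserving and
-- c′ : X → [t] minimal off A; counting both sides gives Ω(P,t)(t+1)^w ≤ Ω(P,t+1) t^w.
-- On a ∈ A the digits (g a, c a) ∈ [t] × [t+1] are re-read in the other mixed radix,
-- (t+1)·g a + c a = t·g′ a + c′ a, which forces g′ a ∈ {g a, g a + 1}; points strictly above A
-- are raised by one and all others are kept. As A is an antichain no point above A lies in A,
-- so whenever g′ x > g x, every y ≻ x is raised and order is preserved.

open import Defs
open import Data.Nat using (ℕ; suc; _*_; _^_; _≤_)
import Data.Nat as ℕ
open import Data.Nat using (_+_; _<_; z≤n; s≤s; s≤s⁻¹)
open import Data.Nat.Properties
  using (≤-refl; ≤-reflexive; ≤-trans; n≤1+n; m≤m+n; m≤n+m; +-comm; +-assoc; *-comm; *-suc;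
         +-monoʳ-<; +-mono-<-≤; *-cancelˡ-<; module ≤-Reasoning)
open import Data.Fin as F using (Fin; zero; toℕ; inject₁; combine; remQuot; cast)
open import Data.Fin.Properties
  using (toℕ<n; toℕ-injective; toℕ-inject₁; toℕ-cast; toℕ-combine; suc-injective; inject₁-injective;
         combine-injective; combine-remQuot; any?)
open import Data.Fin.Subset using (Subset; inside; outside; ∣_∣) renaming (_∈_ to _∈ₛ_; _∉_ to _∉ₛ_)
open import Data.Fin.Subset.Properties using (_∈?_; drop-there)
open import Data.Vec as V using (Vec; []; _∷_; lookup; tabulate; unzip)
open import Data.Vec.Properties using (∷-injective; ∷-injectiveʳ; lookup∘tabulate; lookup-unzip)
open import Data.Vec.Relation.Binary.Pointwise.Extensional using (ext; Pointwise-≡⇒≡)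
open import Data.List
  using (List; []; _∷_; [_]; _++_; length; map; concatMap; filter; allFin; cartesianProductWith; cartesianProduct)
open import Data.List.Properties using (length-++; length-++-sucʳ; length-map; length-tabulate)
open import Data.List.Membership.Propositional using (_∈_)
open import Data.List.Membership.Propositional.Properties
  using (∈-∃++; ∈-++⁺ˡ; ∈-++⁺ʳ; ∈-++⁻; ∈-map⁺; ∈-map⁻; ∈-allFin; ∈-filter⁺; ∈-filter⁻;
         ∈-cartesianProductWith⁺; ∈-cartesianProductWith⁻; ∈-cartesianProduct⁺; ∈-cartesianProduct⁻)
open import Data.List.Relation.Unary.Any using (here; there)
import Data.List.Relation.Unary.All as All
import Data.List.Relation.Unary.AllPairs as AllPairs
open import Data.List.Relation.Unary.Unique.Propositional using (Unique)
import Data.List.Relation.Unary.Unique.Propositional.Properties as Unique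
open import Data.Product using (∃-syntax; _×_; _,_; proj₁; proj₂; uncurry)
open import Data.Sum using (inj₁; inj₂)
open import Data.Empty using (⊥-elim)
open import Function using (_∘_)
open import Relation.Nullary using (Dec; yes; no; ¬_)
open import Relation.Nullary.Decidable using (_×-dec_)
open import Relation.Binary.PropositionalEquality using (_≡_; refl; sym; trans; cong; cong₂; module ≡-Reasoning)
open import Relation.Binary.Structures using (IsStrictPartialOrder)

length≤-of-injection : ∀ {a b} {A : Set a} {B : Set b} (f : A → B) {xs : List A} {ys : List B} →
  Unique xs → (∀ {x} → x ∈ xs → f x ∈ ys) →
  (∀ {x y} → x ∈ xs → y ∈ xs → f x ≡ f y → x ≡ y) → length xs ≤ length ys
length≤-of-injection f {[]} _ _ _ = z≤n
length≤-of-injection f {x ∷ xs} (x∉xs AllPairs.∷ xs!) maps inj with ∈-∃++ (maps (here refl))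
... | ys₁ , ys₂ , refl = begin
  suc (length xs)            ≤⟨ s≤s (length≤-of-injection f xs! maps′ (λ p q → inj (there p) (there q))) ⟩
  suc (length (ys₁ ++ ys₂))  ≡⟨ length-++-sucʳ ys₁ (f x) ys₂ ⟨
  length (ys₁ ++ f x ∷ ys₂)  ∎
  where
  open ≤-Reasoning
  maps′ : ∀ {y} → y ∈ xs → f y ∈ ys₁ ++ ys₂
  maps′ y∈xs with ∈-++⁻ ys₁ (maps (there y∈xs))
  ... | inj₁ p           = ∈-++⁺ˡ p
  ... | inj₂ (here fy≡fx) = ⊥-elim (All.lookup x∉xs y∈xs (inj (here refl) (there y∈xs) (sym fy≡fx)))
  ... | inj₂ (there p)   = ∈-++⁺ʳ ys₁ p

length-cartesianProductWith : ∀ {A B C : Set} (f : A → B → C) (xs : List A) (ys : List B) →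
  length (cartesianProductWith f xs ys) ≡ length xs * length ys
length-cartesianProductWith f [] ys = refl
length-cartesianProductWith f (x ∷ xs) ys = begin
  length (map (f x) ys ++ cartesianProductWith f xs ys) ≡⟨ length-++ (map (f x) ys) ⟩
  length (map (f x) ys) + length (cartesianProductWith f xs ys)
    ≡⟨ cong₂ _+_ (length-map (f x) ys) (length-cartesianProductWith f xs ys) ⟩
  length ys + length xs * length ys ∎
  where open ≡-Reasoning

concatMap-map≡cartesianProductWith : ∀ {A B C : Set} (f : A → B → C) (xs : List A) (ys : List B) →
  concatMap (λ x → map (f x) ys) xs ≡ cartesianProductWith f xs ys
concatMap-map≡cartesianProductWith f []       ys = refl
concatMap-map≡cartesianProductWith f (x ∷ xs) ys =
  cong (map (f x) ys ++_) (concatMap-map≡cartesianProductWith f xs ys)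

allMaps-suc : ∀ m t → allMaps (suc m) t ≡ cartesianProductWith _∷_ (allFin t) (allMaps m t)
allMaps-suc m t = concatMap-map≡cartesianProductWith _∷_ (allFin t) (allMaps m t)

allMaps-unique : ∀ m t → Unique (allMaps m t)
allMaps-unique ℕ.zero  t = All.[] AllPairs.∷ AllPairs.[]
allMaps-unique (suc m) t rewrite allMaps-suc m t =
  Unique.cartesianProductWith⁺ _∷_ ∷-injective (Unique.allFin⁺ t) (allMaps-unique m t)

∈-allMaps : ∀ {m t} (g : Vec (Fin t) m) → g ∈ allMaps m t
∈-allMaps {ℕ.zero}      []      = here refl
∈-allMaps {suc m} {t} (i ∷ g) rewrite allMaps-suc m t =
  ∈-cartesianProductWith⁺ _∷_ (∈-allFin i) (∈-allMaps g)

supportedIn : ∀ {n} s → Subset n → List (Vec (Fin (suc s)) n)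
supportedIn s []            = [ [] ]
supportedIn s (inside ∷ A)  = cartesianProductWith _∷_ (allFin (suc s)) (supportedIn s A)
supportedIn s (outside ∷ A) = map (zero ∷_) (supportedIn s A)

length-supportedIn : ∀ {n} s (A : Subset n) → length (supportedIn s A) ≡ suc s ^ ∣ A ∣
length-supportedIn s []            = refl
length-supportedIn s (inside ∷ A)  = begin
  length (cartesianProductWith _∷_ (allFin (suc s)) (supportedIn s A))
    ≡⟨ length-cartesianProductWith _∷_ (allFin (suc s)) (supportedIn s A) ⟩
  length (allFin (suc s)) * length (supportedIn s A)
    ≡⟨ cong₂ _*_ (length-tabulate {n = suc s} (λ i → i)) (length-supportedIn s A) ⟩
  suc s * suc s ^ ∣ A ∣ ∎
  where open ≡-Reasoning
length-supportedIn s (outside ∷ A) =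
  trans (length-map (zero ∷_) (supportedIn s A)) (length-supportedIn s A)

supportedIn-unique : ∀ {n} s (A : Subset n) → Unique (supportedIn s A)
supportedIn-unique s []            = All.[] AllPairs.∷ AllPairs.[]
supportedIn-unique s (inside ∷ A)  =
  Unique.cartesianProductWith⁺ _∷_ ∷-injective (Unique.allFin⁺ (suc s)) (supportedIn-unique s A)
supportedIn-unique s (outside ∷ A) = Unique.map⁺ ∷-injectiveʳ (supportedIn-unique s A)

∈-supportedIn⁺ : ∀ {n s} {A : Subset n} {c : Vec (Fin (suc s)) n} →
  (∀ x → x ∉ₛ A → lookup c x ≡ zero) → c ∈ supportedIn s A
∈-supportedIn⁺ {A = []}          {[]}    _ = here refl
∈-supportedIn⁺ {A = inside ∷ A}  {i ∷ c} vanish =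
  ∈-cartesianProductWith⁺ _∷_ (∈-allFin i) (∈-supportedIn⁺ λ x x∉A → vanish (F.suc x) (x∉A ∘ drop-there))
∈-supportedIn⁺ {A = outside ∷ A} {i ∷ c} vanish rewrite vanish zero (λ ()) =
  ∈-map⁺ (zero ∷_) (∈-supportedIn⁺ λ x x∉A → vanish (F.suc x) (x∉A ∘ drop-there))

∈-supportedIn⁻ : ∀ {n s} {A : Subset n} {c : Vec (Fin (suc s)) n} →
  c ∈ supportedIn s A → ∀ x → x ∉ₛ A → lookup c x ≡ zero
∈-supportedIn⁻ {A = inside ∷ A} c∈ x x∉A
  with _ , _ , _ , c′∈ , refl ← ∈-cartesianProductWith⁻ _∷_ (allFin _) (supportedIn _ A) c∈
  with x
... | zero  = ⊥-elim (x∉A V.here)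
... | F.suc x = ∈-supportedIn⁻ c′∈ x (x∉A ∘ V.there)
∈-supportedIn⁻ {A = outside ∷ A} c∈ x x∉A
  with _ , c′∈ , refl ← ∈-map⁻ (zero ∷_) c∈
  with x
... | zero  = refl
... | F.suc x = ∈-supportedIn⁻ c′∈ x (x∉A ∘ V.there)

quotient-between : ∀ {t q r u c} → t * q + r ≡ suc t * u + c → r < t → u < t → c ≤ t →
  u ≤ q × q ≤ suc u
quotient-between {t} {q} {r} {u} {c} eq r<t u<t c≤t = s≤s⁻¹ u<1+q , s≤s⁻¹ q<2+u
  where
  open ≤-Reasoning
  u<1+q : u < suc q
  u<1+q = *-cancelˡ-< t u (suc q) (begin-strict
    t * u          ≤⟨ ≤-trans (m≤n+m (t * u) u) (m≤m+n (u + t * u) c) ⟩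
    suc t * u + c  ≡⟨ eq ⟨
    t * q + r      <⟨ +-monoʳ-< (t * q) r<t ⟩
    t * q + t      ≡⟨ +-comm (t * q) t ⟩
    t + t * q      ≡⟨ *-suc t q ⟨
    t * suc q      ∎)
  q<2+u : q < suc (suc u)
  q<2+u = *-cancelˡ-< t q (suc (suc u)) (begin-strict
    t * q                ≤⟨ m≤m+n (t * q) r ⟩
    t * q + r            ≡⟨ eq ⟩
    u + t * u + c        ≡⟨ cong (_+ c) (+-comm u (t * u)) ⟩
    t * u + u + c        ≡⟨ +-assoc (t * u) u c ⟩
    t * u + (u + c)      <⟨ +-monoʳ-< (t * u) (+-mono-<-≤ u<t c≤t) ⟩
    t * u + (t + t)      ≡⟨ +-comm (t * u) (t + t) ⟩
    t + t + t * u        ≡⟨ +-assoc t t (t * u) ⟩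
    t + (t + t * u)      ≡⟨ cong (t +_) (*-suc t u) ⟨
    t + t * suc u        ≡⟨ *-suc t (suc u) ⟨
    t * suc (suc u)      ∎)

rebalance : ∀ {t} → Fin t → Fin (suc t) → Fin (suc t) × Fin t
rebalance {t} u c = remQuot t (cast (*-comm t (suc t)) (combine u c))

toℕ-combine-rebalance : ∀ {t} (u : Fin t) (c : Fin (suc t)) →
  toℕ (uncurry combine (rebalance u c)) ≡ toℕ (combine u c)
toℕ-combine-rebalance {t} u c =
  trans (cong toℕ (combine-remQuot t (cast (*-comm t (suc t)) (combine u c)))) (toℕ-cast _ (combine u c))

rebalance-injective : ∀ {t} {u₁ u₂ : Fin t} {c₁ c₂ : Fin (suc t)} →
  rebalance u₁ c₁ ≡ rebalance u₂ c₂ → u₁ ≡ u₂ × c₁ ≡ c₂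
rebalance-injective {u₁ = u₁} {u₂} {c₁} {c₂} eq = combine-injective u₁ c₁ u₂ c₂ (toℕ-injective (begin
  toℕ (combine u₁ c₁)                       ≡⟨ toℕ-combine-rebalance u₁ c₁ ⟨
  toℕ (uncurry combine (rebalance u₁ c₁))   ≡⟨ cong (toℕ ∘ uncurry combine) eq ⟩
  toℕ (uncurry combine (rebalance u₂ c₂))   ≡⟨ toℕ-combine-rebalance u₂ c₂ ⟩
  toℕ (combine u₂ c₂)                       ∎))
  where open ≡-Reasoning

rebalance-between : ∀ {t} (u : Fin t) (c : Fin (suc t)) →
  toℕ u ≤ toℕ (proj₁ (rebalance u c)) × toℕ (proj₁ (rebalance u c)) ≤ suc (toℕ u)
rebalance-between {t} u c = quotient-between eq (toℕ<n r) (toℕ<n u) (s≤s⁻¹ (toℕ<n c))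
  where
  q : Fin (suc t)
  q = proj₁ (rebalance u c)
  r : Fin t
  r = proj₂ (rebalance u c)
  eq : t * toℕ q + toℕ r ≡ suc t * toℕ u + toℕ c
  eq = trans (sym (toℕ-combine q r)) (trans (toℕ-combine-rebalance u c) (toℕ-combine u c))

module _ {n} (P : FinPoset n) where
  open FinPoset P
  open IsStrictPartialOrder isStrictPO using (irrefl)

  orderPreservingMaps : ∀ t → List (Vec (Fin t) n)
  orderPreservingMaps t = filter (orderPreserving? P) (allMaps n t)

  Above : Subset n → Fin n → Set
  Above A y = ∃[ a ] a ∈ₛ A × a ≺ y

  above? : ∀ A y → Dec (Above A y)
  above? A y = any? λ a → (a ∈? A) ×-dec (a ≺? y)

  above-antichain-∉ : ∀ {A y} → IsAntichain P A → Above A y → y ∉ₛ A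
  above-antichain-∉ {y = y} anti (a , a∈A , a≺y) y∈A =
    anti a y a∈A y∈A (λ a≡y → irrefl a≡y a≺y) (inj₁ a≺y)

module Lift {n} (P : FinPoset n) {A : Subset n} (anti : IsAntichain P A) (t : ℕ) where
  open FinPoset P
  open IsStrictPartialOrder isStrictPO using () renaming (trans to ≺-trans)

  step : Fin n → Fin (suc t) → Fin (suc (suc t)) → Fin (suc (suc t)) × Fin (suc t)
  step x u c with x ∈? A | above? P A x
  ... | yes _ | _     = rebalance u c
  ... | no _  | yes _ = F.suc u , zero
  ... | no _  | no _  = inject₁ u , zero

  step-between : ∀ x u c →
    toℕ u ≤ toℕ (proj₁ (step x u c)) × toℕ (proj₁ (step x u c)) ≤ suc (toℕ u)
  step-between x u c with x ∈? A | above? P A x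
  ... | yes _ | _     = rebalance-between u c
  ... | no _  | yes _ = n≤1+n (toℕ u) , ≤-refl
  ... | no _  | no _  = ≤-reflexive (sym (toℕ-inject₁ u)) , ≤-trans (≤-reflexive (toℕ-inject₁ u)) (n≤1+n (toℕ u))

  step-above : ∀ {x} u c → Above P A x → toℕ (proj₁ (step x u c)) ≡ suc (toℕ u)
  step-above {x} u c x↑ with x ∈? A | above? P A x
  ... | yes x∈A | _      = ⊥-elim (above-antichain-∉ P anti x↑ x∈A)
  ... | no _    | yes _  = refl
  ... | no _    | no ¬x↑ = ⊥-elim (¬x↑ x↑)

  step-not-above : ∀ {x} u c → x ∉ₛ A → ¬ Above P A x → toℕ (proj₁ (step x u c)) ≡ toℕ u
  step-not-above {x} u c x∉A ¬x↑ with x ∈? A | above? P A x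
  ... | yes x∈A | _     = ⊥-elim (x∉A x∈A)
  ... | no _    | yes x↑ = ⊥-elim (¬x↑ x↑)
  ... | no _    | no _  = toℕ-inject₁ u

  step-∉ : ∀ {x} u c → x ∉ₛ A → proj₂ (step x u c) ≡ zero
  step-∉ {x} u c x∉A with x ∈? A | above? P A x
  ... | yes x∈A | _     = ⊥-elim (x∉A x∈A)
  ... | no _    | yes _ = refl
  ... | no _    | no _  = refl

  step-injective : ∀ {x u₁ u₂ c₁ c₂} → (x ∉ₛ A → c₁ ≡ zero) → (x ∉ₛ A → c₂ ≡ zero) →
    step x u₁ c₁ ≡ step x u₂ c₂ → u₁ ≡ u₂ × c₁ ≡ c₂
  step-injective {x} c₁≡0 c₂≡0 eq with x ∈? A | above? P A x
  ... | yes _   | _     = rebalance-injective eq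
  ... | no x∉A  | yes _ = suc-injective (cong proj₁ eq) , trans (c₁≡0 x∉A) (sym (c₂≡0 x∉A))
  ... | no x∉A  | no _  = inject₁-injective (cong proj₁ eq) , trans (c₁≡0 x∉A) (sym (c₂≡0 x∉A))

  step-monotone : ∀ {x y} → x ≺ y → ∀ {u₁ u₂} c₁ c₂ → toℕ u₁ ≤ toℕ u₂ →
    toℕ (proj₁ (step x u₁ c₁)) ≤ toℕ (proj₁ (step y u₂ c₂))
  step-monotone {x} {y} x≺y {u₁} {u₂} c₁ c₂ u₁≤u₂ = by-cases (above? P A y)
    where
    open ≤-Reasoning
    by-cases : Dec (Above P A y) → toℕ (proj₁ (step x u₁ c₁)) ≤ toℕ (proj₁ (step y u₂ c₂))
    by-cases (yes y↑) = begin
      toℕ (proj₁ (step x u₁ c₁)) ≤⟨ proj₂ (step-between x u₁ c₁) ⟩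
      suc (toℕ u₁)               ≤⟨ s≤s u₁≤u₂ ⟩
      suc (toℕ u₂)               ≡⟨ step-above u₂ c₂ y↑ ⟨
      toℕ (proj₁ (step y u₂ c₂)) ∎
    by-cases (no ¬y↑) = begin
      toℕ (proj₁ (step x u₁ c₁)) ≡⟨ step-not-above u₁ c₁ (λ x∈A → ¬y↑ (x , x∈A , x≺y))
                                       (λ (a , a∈A , a≺x) → ¬y↑ (a , a∈A , ≺-trans a≺x x≺y)) ⟩
      toℕ u₁                     ≤⟨ u₁≤u₂ ⟩
      toℕ u₂                     ≤⟨ proj₁ (step-between y u₂ c₂) ⟩
      toℕ (proj₁ (step y u₂ c₂)) ∎

  lift : Vec (Fin (suc t)) n × Vec (Fin (suc (suc t))) n → Vec (Fin (suc (suc t))) n × Vec (Fin (suc t)) n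
  lift (g , c) = unzip (tabulate λ x → step x (lookup g x) (lookup c x))

  lookup-lift : ∀ g c x →
    (lookup (proj₁ (lift (g , c))) x , lookup (proj₂ (lift (g , c))) x) ≡ step x (lookup g x) (lookup c x)
  lookup-lift g c x = trans (lookup-unzip x (tabulate entry)) (lookup∘tabulate entry x)
    where
    entry : Fin n → Fin (suc (suc t)) × Fin (suc t)
    entry x = step x (lookup g x) (lookup c x)

  lift-orderPreserving : ∀ {g} c → OrderPreserving P g → OrderPreserving P (proj₁ (lift (g , c)))
  lift-orderPreserving {g} c g↗ x y x≺y
    rewrite cong proj₁ (lookup-lift g c x) | cong proj₁ (lookup-lift g c y) =
    step-monotone x≺y (lookup c x) (lookup c y) (g↗ x y x≺y)

  lift-supported : ∀ g c → proj₂ (lift (g , c)) ∈ supportedIn t A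
  lift-supported g c = ∈-supportedIn⁺ λ x x∉A →
    trans (cong proj₂ (lookup-lift g c x)) (step-∉ (lookup g x) (lookup c x) x∉A)

  lift-injective : ∀ {g₁ g₂ c₁ c₂} → c₁ ∈ supportedIn (suc t) A → c₂ ∈ supportedIn (suc t) A →
    lift (g₁ , c₁) ≡ lift (g₂ , c₂) → (g₁ , c₁) ≡ (g₂ , c₂)
  lift-injective {g₁} {g₂} {c₁} {c₂} c₁∈ c₂∈ eq =
    cong₂ _,_ (Pointwise-≡⇒≡ (ext (proj₁ ∘ pointwise))) (Pointwise-≡⇒≡ (ext (proj₂ ∘ pointwise)))
    where
    pointwise : ∀ x → lookup g₁ x ≡ lookup g₂ x × lookup c₁ x ≡ lookup c₂ x
    pointwise x = step-injective (∈-supportedIn⁻ c₁∈ x) (∈-supportedIn⁻ c₂∈ x) (begin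
      step x (lookup g₁ x) (lookup c₁ x)                          ≡⟨ lookup-lift g₁ c₁ x ⟨
      (lookup (proj₁ (lift (g₁ , c₁))) x , lookup (proj₂ (lift (g₁ , c₁))) x)
        ≡⟨ cong (λ gc → lookup (proj₁ gc) x , lookup (proj₂ gc) x) eq ⟩
      (lookup (proj₁ (lift (g₂ , c₂))) x , lookup (proj₂ (lift (g₂ , c₂))) x) ≡⟨ lookup-lift g₂ c₂ x ⟩
      step x (lookup g₂ x) (lookup c₂ x)                          ∎)
      where open ≡-Reasoning

  source : List (Vec (Fin (suc t)) n × Vec (Fin (suc (suc t))) n)
  source = cartesianProduct (orderPreservingMaps P (suc t)) (supportedIn (suc t) A)

  target : List (Vec (Fin (suc (suc t))) n × Vec (Fin (suc t)) n)
  target = cartesianProduct (orderPreservingMaps P (suc (suc t))) (supportedIn t A)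

  source-unique : Unique source
  source-unique = Unique.cartesianProduct⁺
    (Unique.filter⁺ (orderPreserving? P) (allMaps-unique n (suc t))) (supportedIn-unique (suc t) A)

  lift-∈-target : ∀ {gc} → gc ∈ source → lift gc ∈ target
  lift-∈-target {g , c} gc∈ with g∈ , _ ← ∈-cartesianProduct⁻ (orderPreservingMaps P (suc t)) _ gc∈ =
    ∈-cartesianProduct⁺
      (∈-filter⁺ (orderPreserving? P) (∈-allMaps _)
        (lift-orderPreserving {g} c (proj₂ (∈-filter⁻ (orderPreserving? P) {xs = allMaps n (suc t)} g∈))))
      (lift-supported g c)

  lift-injectiveOn-source : ∀ {gc₁ gc₂} → gc₁ ∈ source → gc₂ ∈ source → lift gc₁ ≡ lift gc₂ → gc₁ ≡ gc₂
  lift-injectiveOn-source gc₁∈ gc₂∈ = lift-injective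
    (proj₂ (∈-cartesianProduct⁻ (orderPreservingMaps P (suc t)) _ gc₁∈))
    (proj₂ (∈-cartesianProduct⁻ (orderPreservingMaps P (suc t)) _ gc₂∈))

Ω-antichain-≤ : ∀ {n} (P : FinPoset n) {A : Subset n} → IsAntichain P A → ∀ t →
  Ω P (suc t) * suc (suc t) ^ ∣ A ∣ ≤ Ω P (suc (suc t)) * suc t ^ ∣ A ∣
Ω-antichain-≤ P {A} anti t = begin
  Ω P (suc t) * suc (suc t) ^ ∣ A ∣
    ≡⟨ cong (Ω P (suc t) *_) (length-supportedIn (suc t) A) ⟨
  Ω P (suc t) * length (supportedIn (suc t) A)
    ≡⟨ length-cartesianProductWith _,_ (orderPreservingMaps P (suc t)) (supportedIn (suc t) A) ⟨
  length source
    ≤⟨ length≤-of-injection lift source-unique lift-∈-target lift-injectiveOn-source ⟩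
  length target
    ≡⟨ length-cartesianProductWith _,_ (orderPreservingMaps P (suc (suc t))) (supportedIn t A) ⟩
  Ω P (suc (suc t)) * length (supportedIn t A)
    ≡⟨ cong (Ω P (suc (suc t)) *_) (length-supportedIn t A) ⟩
  Ω P (suc (suc t)) * suc t ^ ∣ A ∣ ∎
  where
  open ≤-Reasoning
  open Lift P anti t

theorem4p15 : ∀ {n} (P : FinPoset n) (w : ℕ) → HasWidth P w →
    ∀ (t : ℕ) → 1 ≤ t →
    Ω P t * (suc t) ^ w ≤ Ω P (suc t) * t ^ w
theorem4p15 P w ((A , anti , refl) , _) (suc t) _ = Ω-antichain-≤ P anti t
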